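{- For every cascade in $\mathsf D$ of height $k$ there is an equivalent BR formula of $\mathsf{Comp}$-height $k+1$.
   Context: Data words: finite sequences $w=(a_1,d_1)\cdots(a_n,d_n)$ over $\Sigma\times\mathcal D$ ($\Sigma$ finite, $\mathcal D$ infinite); $i\sim j$ iff $d_i=d_j$; class successor/predecessor of $i$: nearest later/earlier $j\sim i$. $\mu$-calculus: $\varphi::= x\mid A\mid\neg A\mid \mathsf M\varphi\mid\varphi\vee\varphi\mid\varphi\wedge\varphi\mid\mu x.\varphi\mid\nu x.\varphi$, atoms $A$: letters and $\mathsf S,\mathsf P,\mathsf{first}^g,\mathsf{last}^g,\mathsf{first}^c,\mathsf{last}^c$; $\mathsf M\in\{\mathtt X^g,\mathtt X^c,\mathtt Y^g,\mathtt Y^c\}$ evaluating the argument at successor, class successor, predecessor, class predecessor (false if nonexistent); $\mathsf{first}^g$/$\mathsf{last}^g$ at first/last position; $\mathsf{first}^c$/$\mathsf{last}^c$ where no class predecessor/successor; $\mathsf S$ at $i$ iff $i$ not last and $i+1$ is the class successor of $i$; $\mathsf P$ at $i$ iff $i\ne1$ and $i-1$ is the class predecessor of $i$; $\mu,\nu$ least/greatest fixpoints; $w\models\varphi$ iff $\varphi$ holds at position 1. $\mathsf{Formulas}(M)$: formulas whose unary modalities lie in $M$. $\mathsf{Comp}^0(\Psi)=\emptyset$, $\mathsf{Comp}^{i+1}(\Psi)=\{\psi(\varphi_1,\dots,\varphi_n)\mid\psi(x_1,\dots,x_n)\in\Psi,\varphi_j\in\mathsf{Comp}^i(\Psi)\}$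 (capture-avoiding), $\mathsf{Comp}(\Psi)=\bigcup_i\mathsf{Comp}^i(\Psi)$, $\mathsf{Comp}$-height of $\psi$ = least $i$ with $\psi\in\mathsf{Comp}^i(\Psi)$. BR $=\mathsf{Comp}(\mathsf{Formulas}(\{\mathtt X^c,\mathtt X^g\})\cup\mathsf{Formulas}(\{\mathtt Y^c,\mathtt Y^g\}))$. Marking alphabet $\mathcal M=\{\mathsf P,\neg\mathsf P\}\times\{\mathsf S,\neg\mathsf S\}$; type $\mathrm{tp}(i)=(p,s)$ with $s=\mathsf S$ iff $i$ not last and $i+1$ is the class successor of $i$, $p=\mathsf P$ iff $i\ne1$ and $i-1$ is the class predecessor of $i$. A deterministic class-memory transducer (CMT) is $(Q,\Sigma,\Sigma',\Delta,q_0,F_c,F_g)$ with transition function $\Delta: Q\times(Q\cup\{\top,\bot\})\times\Sigma\times\mathcal M\to Q\times\Sigma'$. A forward CMT on $w$: a run is $q_0q_1\cdots q_n$ with outputs $a'_1\cdots a'_n$ such that $\Delta(q_{i-1},m,a_i,\mathrm{tp}(i))=(q_i,a'_i)$ where $m=\bot$ if $i$ has no class predecessor and $m=q_j$ if $j$ is the class predecessor of $i$; successful if $q_n\in F_g$ and $q_i\in F_c$ for every $i$ with no class successor. A backward CMT processes positions $n,n-1,\dots,1$: state after position $i$ is $q_{n-i+1}$, $\Delta(q_{n-i},m,a_i,\mathrm{tp}(i))=(q_{n-i+1},a'_i)$ with $m=\top$ if $i$ has no class successor and $m=q_{n-j+1}$ if $j$ is the class successor of $i$; successful if $q_n\in F_g$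 and $q_{n-i+1}\in F_c$ for every $i$ with no class predecessor. Output data word: $(a'_1,d_1)\cdots(a'_n,d_n)$. A cascade $\langle\Sigma_0,\mathcal A_1,\Sigma_1,\dots,\mathcal A_n,\Sigma_n\rangle$ of forward/backward CMTs ($\mathcal A_i$ with input alphabet $\Sigma_{i-1}$, output $\Sigma_i$) has height $n$ and accepts $w$ iff, with $w_0=w$, each $\mathcal A_i$ has a successful run on $w_{i-1}$ producing $w_i$. $\mathsf D$: the set of such cascades. A sentence and a cascade are equivalent if the data words satisfying the sentence are exactly those accepted by the cascade. -}

module Defs where

open import Data.Nat using (ℕ; zero; suc; _<_)
open import Data.Fin using (Fin; zero; suc; toℕ)
open import Data.Bool using (Bool; true; false)
open import Data.Product using (Σ; _×_; _,_)
open import Data.Sum using (_⊎_)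
open import Data.Empty using (⊥)
open import Data.Unit using (⊤)
open import Relation.Nullary using (¬_)
open import Relation.Binary.PropositionalEquality using (_≡_; _≢_)
open import Function.Bundles using (_⇔_)

-- Data words.  Finite alphabet Σ = Fin a (or any type A); the infinite
-- data domain 𝒟 is ℕ.  Positions are Fin len (0-indexed: position 1 of
-- the paper is Fin-index zero).

record Word (A : Set) : Set where
  constructor mkWord
  field
    len : ℕ
    lab : Fin len → A
    dat : Fin len → ℕ

open Word public

NonEmpty : {A : Set} → Word A → Set
NonEmpty w = Σ ℕ λ m → len w ≡ suc m

module Positions {A : Set} (w : Word A) where
  SuccG : Fin (len w) → Fin (len w) → Set
  SuccG i j = toℕ j ≡ suc (toℕ i)

  ClassSucc : Fin (len w) → Fin (len w) → Set
  ClassSucc i j =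
    (toℕ i < toℕ j) × (dat w j ≡ dat w i) ×
    ((k : Fin (len w)) → toℕ i < toℕ k → toℕ k < toℕ j → dat w k ≢ dat w i)

  HasClassSucc : Fin (len w) → Set
  HasClassSucc i = Σ (Fin (len w)) λ j → ClassSucc i j

  HasClassPred : Fin (len w) → Set
  HasClassPred i = Σ (Fin (len w)) λ j → ClassSucc j i

  SAt : Fin (len w) → Set
  SAt i = Σ (Fin (len w)) λ j → SuccG i j × ClassSucc i j

  PAt : Fin (len w) → Set
  PAt i = Σ (Fin (len w)) λ j → SuccG j i × ClassSucc j i

-- μ-calculus.  Well-scoped syntax: Formula A m has free variables in
-- Fin m; μ and ν bind variable zero (de Bruijn).

data Atom (A : Set) : Set where
  letter : A → Atom A
  S P firstg lastg firstc lastc : Atom A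

data Modality : Set where
  Xg Xc Yg Yc : Modality

data Formula (A : Set) : ℕ → Set where
  var  : ∀ {m} → Fin m → Formula A m
  pos  : ∀ {m} → Atom A → Formula A m
  neg  : ∀ {m} → Atom A → Formula A m
  mod  : ∀ {m} → Modality → Formula A m → Formula A m
  _∨ᶠ_ : ∀ {m} → Formula A m → Formula A m → Formula A m
  _∧ᶠ_ : ∀ {m} → Formula A m → Formula A m → Formula A m
  μᶠ   : ∀ {m} → Formula A (suc m) → Formula A m
  νᶠ   : ∀ {m} → Formula A (suc m) → Formula A m

module Semantics {A : Set} (w : Word A) where
  open Positions w

  Pos : Set
  Pos = Fin (len w)

  Val : ℕ → Set
  Val m = Fin m → Pos → Bool

  extend : ∀ {m} → (Pos → Bool) → Val m → Val (suc m)
  extend X ρ zero    = X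
  extend X ρ (suc x) = ρ x

  ⟦_⟧ᵃ : Atom A → Pos → Set
  ⟦ letter a ⟧ᵃ i = lab w i ≡ a
  ⟦ S ⟧ᵃ i        = SAt i
  ⟦ P ⟧ᵃ i        = PAt i
  ⟦ firstg ⟧ᵃ i   = toℕ i ≡ 0
  ⟦ lastg ⟧ᵃ i    = suc (toℕ i) ≡ len w
  ⟦ firstc ⟧ᵃ i   = ¬ HasClassPred i
  ⟦ lastc ⟧ᵃ i    = ¬ HasClassSucc i

  ⟦_⟧ : ∀ {m} → Formula A m → Val m → Pos → Set
  ⟦ var x ⟧ ρ i      = ρ x i ≡ true
  ⟦ pos a ⟧ ρ i      = ⟦ a ⟧ᵃ i
  ⟦ neg a ⟧ ρ i      = ¬ ⟦ a ⟧ᵃ i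
  ⟦ mod Xg φ ⟧ ρ i   = Σ Pos λ j → SuccG i j × ⟦ φ ⟧ ρ j
  ⟦ mod Xc φ ⟧ ρ i   = Σ Pos λ j → ClassSucc i j × ⟦ φ ⟧ ρ j
  ⟦ mod Yg φ ⟧ ρ i   = Σ Pos λ j → SuccG j i × ⟦ φ ⟧ ρ j
  ⟦ mod Yc φ ⟧ ρ i   = Σ Pos λ j → ClassSucc j i × ⟦ φ ⟧ ρ j
  ⟦ φ ∨ᶠ ψ ⟧ ρ i     = ⟦ φ ⟧ ρ i ⊎ ⟦ ψ ⟧ ρ i
  ⟦ φ ∧ᶠ ψ ⟧ ρ i     = ⟦ φ ⟧ ρ i × ⟦ ψ ⟧ ρ i
  -- least fixpoint: intersection of all prefixed points (Knaster–Tarski)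
  ⟦ μᶠ φ ⟧ ρ i       =
    (X : Pos → Bool) → ((j : Pos) → ⟦ φ ⟧ (extend X ρ) j → X j ≡ true) → X i ≡ true
  -- greatest fixpoint: union of all postfixed points
  ⟦ νᶠ φ ⟧ ρ i       =
    Σ (Pos → Bool) λ X → ((j : Pos) → X j ≡ true → ⟦ φ ⟧ (extend X ρ) j) × (X i ≡ true)

  emptyVal : Val 0
  emptyVal ()

  Sat : Formula A 0 → Set
  Sat φ = Σ Pos λ i → (toℕ i ≡ 0) × ⟦ φ ⟧ emptyVal i

-- Capture-avoiding substitution (well-scoped, hence automatic)

rename : ∀ {A m k} → (Fin m → Fin k) → Formula A m → Formula A k
rename r (var x)   = var (r x)
rename r (pos a)   = pos a
rename r (neg a)   = neg a
rename r (mod M φ) = mod M (rename r φ)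
rename r (φ ∨ᶠ ψ)  = rename r φ ∨ᶠ rename r ψ
rename r (φ ∧ᶠ ψ)  = rename r φ ∧ᶠ rename r ψ
rename r (μᶠ φ)    = μᶠ (rename (lift r) φ)
  where lift : _ → _
        lift r zero = zero
        lift r (suc x) = suc (r x)
rename r (νᶠ φ)    = νᶠ (rename (lift r) φ)
  where lift : _ → _
        lift r zero = zero
        lift r (suc x) = suc (r x)

exts : ∀ {A m k} → (Fin m → Formula A k) → Fin (suc m) → Formula A (suc k)
exts σ zero    = var zero
exts σ (suc x) = rename suc (σ x)

subst : ∀ {A m k} → Formula A m → (Fin m → Formula A k) → Formula A k
subst (var x)   σ = σ x
subst (pos a)   σ = pos a
subst (neg a)   σ = neg a
subst (mod M φ) σ = mod M (subst φ σ)
subst (φ ∨ᶠ ψ)  σ = subst φ σ ∨ᶠ subst ψ σ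
subst (φ ∧ᶠ ψ)  σ = subst φ σ ∧ᶠ subst ψ σ
subst (μᶠ φ)    σ = μᶠ (subst φ (exts σ))
subst (νᶠ φ)    σ = νᶠ (subst φ (exts σ))

Formulas : ∀ {A m} → (Modality → Set) → Formula A m → Set
Formulas M (var x)   = ⊤
Formulas M (pos a)   = ⊤
Formulas M (neg a)   = ⊤
Formulas M (mod N φ) = M N × Formulas M φ
Formulas M (φ ∨ᶠ ψ)  = Formulas M φ × Formulas M ψ
Formulas M (φ ∧ᶠ ψ)  = Formulas M φ × Formulas M ψ
Formulas M (μᶠ φ)    = Formulas M φ
Formulas M (νᶠ φ)    = Formulas M φ

FutureMods : Modality → Set
FutureMods Xg = ⊤
FutureMods Xc = ⊤
FutureMods Yg = ⊥
FutureMods Yc = ⊥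

PastMods : Modality → Set
PastMods Xg = ⊥
PastMods Xc = ⊥
PastMods Yg = ⊤
PastMods Yc = ⊤

-- Comp^i(Ψ) : ψ(x_1..x_n) ∈ Ψ with free variables among x_1..x_n
-- (Fin n), instantiated with φ_1..φ_n ∈ Comp^{i-1}(Ψ).
Comp : {A : Set} → (∀ {m} → Formula A m → Set) → ℕ → Formula A 0 → Set
Comp Ψ zero    φ = ⊥
Comp Ψ (suc i) φ =
  Σ ℕ λ n → Σ (Formula _ n) λ ψ → Ψ ψ ×
    Σ (Fin n → Formula _ 0) λ σ → ((j : Fin n) → Comp Ψ i (σ j)) × (φ ≡ subst ψ σ)

BRbase : {A : Set} → ∀ {m} → Formula A m → Set
BRbase ψ = Formulas FutureMods ψ ⊎ Formulas PastMods ψ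

data Mem (Q : Set) : Set where
  st  : Q → Mem Q
  top : Mem Q
  bot : Mem Q

-- Marking alphabet 𝓜 = {P,¬P} × {S,¬S}; first component true = P,
-- second component true = S.
Marking : Set
Marking = Bool × Bool

record CMT (a b : ℕ) : Set where
  field
    nQ : ℕ
    Δ  : Fin nQ → Mem (Fin nQ) → Fin a → Marking → Fin nQ × Fin b
    q₀ : Fin nQ
    Fc : Fin nQ → Bool
    Fg : Fin nQ → Bool

data Direction : Set where
  forward backward : Direction

module Runs {a b : ℕ} (w : Word (Fin a)) (T : CMT a b) where
  open Positions w
  open CMT T

  Pos : Set
  Pos = Fin (len w)

  TypeIs : Pos → Marking → Set
  TypeIs i (p , s) = ((p ≡ true) ⇔ PAt i) × ((s ≡ true) ⇔ SAt i)

  -- A run q₀ q₁ … q_n is given by q₀ and `after i`, the state reached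
  -- right after processing position i, with outputs `out i`.
  Successful : Direction → (Pos → Fin nQ) → (Pos → Fin b) → Set
  Successful forward after out =
    ((i : Pos) (q : Fin nQ) (m : Mem (Fin nQ)) (t : Marking) →
       Before i q → MemF i m → TypeIs i t →
       Δ q m (lab w i) t ≡ (after i , out i))
    × ((q : Fin nQ) → Final q → Fg q ≡ true)
    × ((i : Pos) → ¬ HasClassSucc i → Fc (after i) ≡ true)
    where
      Before : Pos → Fin nQ → Set
      Before i q = (toℕ i ≡ 0 × q ≡ q₀) ⊎ Σ Pos λ j → SuccG j i × q ≡ after j
      MemF : Pos → Mem (Fin nQ) → Set
      MemF i m = (m ≡ bot × ¬ HasClassPred i) ⊎ Σ Pos λ j → ClassSucc j i × m ≡ st (after j)
      Final : Fin nQ → Set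
      Final q = (len w ≡ 0 × q ≡ q₀) ⊎ Σ Pos λ j → suc (toℕ j) ≡ len w × q ≡ after j
  Successful backward after out =
    ((i : Pos) (q : Fin nQ) (m : Mem (Fin nQ)) (t : Marking) →
       Before i q → MemB i m → TypeIs i t →
       Δ q m (lab w i) t ≡ (after i , out i))
    × ((q : Fin nQ) → Final q → Fg q ≡ true)
    × ((i : Pos) → ¬ HasClassPred i → Fc (after i) ≡ true)
    where
      Before : Pos → Fin nQ → Set
      Before i q = (suc (toℕ i) ≡ len w × q ≡ q₀) ⊎ Σ Pos λ j → SuccG i j × q ≡ after j
      MemB : Pos → Mem (Fin nQ) → Set
      MemB i m = (m ≡ top × ¬ HasClassSucc i) ⊎ Σ Pos λ j → ClassSucc i j × m ≡ st (after j)
      Final : Fin nQ → Set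
      Final q = (len w ≡ 0 × q ≡ q₀) ⊎ Σ Pos λ j → toℕ j ≡ 0 × q ≡ after j

  RunsTo : Direction → (Pos → Fin b) → Set
  RunsTo d out = Σ (Pos → Fin nQ) λ after → Successful d after out

relabel : {A B : Set} (w : Word A) → (Fin (len w) → B) → Word B
relabel w out = mkWord (len w) out (dat w)

-- Cascades ⟨Σ₀, 𝒜₁, Σ₁, …, 𝒜ₖ, Σₖ⟩ with Σᵢ = Fin aᵢ, indexed by height
data Cascade : ℕ → ℕ → Set where
  []  : ∀ {a} → Cascade a 0
  _∷_ : ∀ {a b k} → Direction × CMT a b → Cascade b k → Cascade a (suc k)

Accepts : ∀ {a k} → Cascade a k → Word (Fin a) → Set
Accepts [] w = ⊤
Accepts ((d , T) ∷ C) w =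
  Σ (Fin (len w) → _) λ out → Runs.RunsTo w T d out × Accepts C (relabel w out)

module Submission where

-- A deterministic CMT reading in direction d has exactly one run: the state
-- after position i is the transition taken from the states at the global and
-- class neighbours of i read before it, so the run is defined by well-founded
-- recursion along the reading order (Run).  Its graph is the unique solution
-- of the system "X_q holds at i iff the transition at i leads to q", whose
-- right-hand sides only look at the neighbours read before; solving it by
-- nested least fixpoints (Bekić) yields formulas StateF q and OutputF o of the
-- past (forward CMT) or future (backward CMT) fragment defining the run and
-- its output (Encoding, LevelSemantics).  Substituting the output formulas of
-- one level for the letters of the next raises the Comp-height by one per
-- level; one future formula, the conjunction of the acceptance conditions of
-- all levels with the state formulas substituted for its variables, then
-- expresses acceptance by the cascade (encode, encode-height, encode-sem).

open import Defs
open import Level using (0ℓ)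
open import Data.Nat using (ℕ; zero; suc; _+_; _≤_; _<_; _<?_; s≤s; z≤n)
import Data.Nat.Properties as ℕₚ
open import Data.Fin using (Fin; zero; suc; toℕ; fromℕ<; _↑ˡ_; _↑ʳ_)
open import Data.Fin.Properties using (_≟_; any?; all?; toℕ-injective; toℕ<n; toℕ-fromℕ<; pigeonhole)
open import Data.Fin.Induction using (<-wellFounded; >-wellFounded)
open import Data.Vec using (Vec; []; _∷_; lookup)
open import Data.Vec.Functional using (_++_)
open import Data.Vec.Functional.Properties using (lookup-++ˡ; lookup-++ʳ)
open import Data.Vec.Functional.Relation.Unary.All.Properties using (++⁺)
open import Data.Bool using (Bool; true; false)
open import Data.Product using (Σ; _×_; _,_; proj₁; proj₂; map₂)
open import Data.Product.Properties using (,-injectiveˡ; ,-injectiveʳ)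
open import Data.Sum using (_⊎_; inj₁; inj₂)
open import Data.Empty using (⊥-elim)
open import Data.Unit using (⊤; tt)
open import Function using (_∘_)
open import Function.Bundles using (_⇔_; mk⇔; Equivalence)
open import Function.Definitions using (Injective)
open import Function.Properties.Equivalence using ()
  renaming (refl to ⇔-refl; sym to ⇔-sym; trans to ⇔-trans)
open import Function.Related.TypeIsomorphisms using (→-cong-⇔)
open import Data.Product.Function.NonDependent.Propositional using (_×-⇔_)
open import Data.Sum.Function.Propositional using (_⊎-⇔_)
open import Induction.WellFounded using (WellFounded; module All; module FixPoint)
open import Relation.Nullary using (¬_; Dec; yes; no; does)
open import Relation.Nullary.Decidable using (_×-dec_; _→-dec_; ¬?)
open import Relation.Binary using (tri<; tri≈; tri>)
open import Relation.Binary.PropositionalEquality using (_≡_; refl; sym; trans; cong; cong₂)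

open Equivalence using (to; from)

Σ-⇔ : {I : Set} {B C : I → Set} → (∀ i → B i ⇔ C i) → Σ I B ⇔ Σ I C
Σ-⇔ h = mk⇔ (map₂ λ {i} → to (h i)) (map₂ λ {i} → from (h i))

Π-⇔ : {I : Set} {B C : I → Set} → (∀ i → B i ⇔ C i) → ((i : I) → B i) ⇔ ((i : I) → C i)
Π-⇔ h = mk⇔ (λ f i → to (h i) (f i)) (λ f i → from (h i) (f i))

≡-true-⇔ : {b c : Bool} → b ≡ c → (b ≡ true) ⇔ (c ≡ true)
≡-true-⇔ b≡c = mk⇔ (trans (sym b≡c)) (trans b≡c)

reflects-⇔ : {X : Set} (x? : Dec X) (b : Bool) → ((b ≡ true) ⇔ X) ⇔ (b ≡ does x?)
reflects-⇔ (yes x) true  = mk⇔ (λ _ → refl) (λ _ → mk⇔ (λ _ → x) (λ _ → refl))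
reflects-⇔ (yes x) false = mk⇔ (λ b⇔X → from b⇔X x) (λ ())
reflects-⇔ (no ¬x) true  = mk⇔ (λ b⇔X → ⊥-elim (¬x (to b⇔X refl))) (λ ())
reflects-⇔ (no ¬x) false = mk⇔ (λ _ → refl) (λ _ → mk⇔ (λ ()) (λ x → ⊥-elim (¬x x)))

does-true-⇔ : {X : Set} (x? : Dec X) → (does x? ≡ true) ⇔ X
does-true-⇔ x? = from (reflects-⇔ x? (does x?)) refl

pair-⇔ : {X Y : Set} {x x' : X} {y y' : Y} → (x ≡ x' × y ≡ y') ⇔ ((x , y) ≡ (x' , y'))
pair-⇔ = mk⇔ (λ (x≡ , y≡) → cong₂ _,_ x≡ y≡) (λ xy≡ → ,-injectiveˡ xy≡ , ,-injectiveʳ xy≡)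

contract : {X : Set} {B : X → Set} {x₀ : X} → (Σ X λ x → x ≡ x₀ × B x) ⇔ B x₀
contract = mk⇔ (λ { (_ , refl , b) → b }) (λ b → _ , refl , b)

contract₂ : {X Y : Set} {B : X → Y → Set} {x₀ : X} {y₀ : Y} →
            (Σ X λ x → Σ Y λ y → (x ≡ x₀ × y ≡ y₀) × B x y) ⇔ B x₀ y₀
contract₂ = mk⇔ (λ { (_ , _ , (refl , refl) , b) → b }) (λ b → _ , _ , (refl , refl) , b)

¬⊎-⇔ : {X Y : Set} → Dec X → (¬ X ⊎ Y) ⇔ (X → Y)
¬⊎-⇔ x? = mk⇔ (λ { (inj₁ ¬x) x → ⊥-elim (¬x x) ; (inj₂ y) _ → y }) (by-cases x?)
  where
  by-cases : ∀ {X Y} → Dec X → (X → Y) → ¬ X ⊎ Y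
  by-cases (yes x) x⇒y = inj₂ (x⇒y x)
  by-cases (no ¬x) _   = inj₁ ¬x

subst-rename : ∀ {A m k l} (ψ : Formula A m) (r : Fin m → Fin k)
               {τ : Fin k → Formula A l} {τ' : Fin m → Formula A l} →
               (∀ x → τ (r x) ≡ τ' x) → subst (rename r ψ) τ ≡ subst ψ τ'
subst-rename (var x)   r h = h x
subst-rename (pos a)   r h = refl
subst-rename (neg a)   r h = refl
subst-rename (mod M φ) r h = cong (mod M) (subst-rename φ r h)
subst-rename (φ ∨ᶠ ψ)  r h = cong₂ _∨ᶠ_ (subst-rename φ r h) (subst-rename ψ r h)
subst-rename (φ ∧ᶠ ψ)  r h = cong₂ _∧ᶠ_ (subst-rename φ r h) (subst-rename ψ r h)
subst-rename (μᶠ φ)    r h =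
  cong μᶠ (subst-rename φ _ λ { zero → refl ; (suc x) → cong (rename suc) (h x) })
subst-rename (νᶠ φ)    r h =
  cong νᶠ (subst-rename φ _ λ { zero → refl ; (suc x) → cong (rename suc) (h x) })

module SubstitutionSemantics {A : Set} (w : Word A) where
  open Semantics w

  mod-⇔ : ∀ {m k} M {φ : Formula A m} {φ' : Formula A k} {ρ ρ'} →
          (∀ j → ⟦ φ ⟧ ρ j ⇔ ⟦ φ' ⟧ ρ' j) → ∀ i → ⟦ mod M φ ⟧ ρ i ⇔ ⟦ mod M φ' ⟧ ρ' i
  mod-⇔ Xg h i = Σ-⇔ λ j → ⇔-refl ×-⇔ h j
  mod-⇔ Xc h i = Σ-⇔ λ j → ⇔-refl ×-⇔ h j
  mod-⇔ Yg h i = Σ-⇔ λ j → ⇔-refl ×-⇔ h j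
  mod-⇔ Yc h i = Σ-⇔ λ j → ⇔-refl ×-⇔ h j

  μ-⇔ : ∀ {m k} (φ : Formula A (suc m)) (φ' : Formula A (suc k)) {ρ ρ'} →
        (∀ X j → ⟦ φ ⟧ (extend X ρ) j ⇔ ⟦ φ' ⟧ (extend X ρ') j) →
        ∀ i → ⟦ μᶠ φ ⟧ ρ i ⇔ ⟦ μᶠ φ' ⟧ ρ' i
  μ-⇔ _ _ h i = mk⇔ (λ lfp X pre → lfp X λ j φj → pre j (to (h X j) φj))
                (λ lfp X pre → lfp X λ j φj → pre j (from (h X j) φj))

  ν-⇔ : ∀ {m k} (φ : Formula A (suc m)) (φ' : Formula A (suc k)) {ρ ρ'} →
        (∀ X j → ⟦ φ ⟧ (extend X ρ) j ⇔ ⟦ φ' ⟧ (extend X ρ') j) →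
        ∀ i → ⟦ νᶠ φ ⟧ ρ i ⇔ ⟦ νᶠ φ' ⟧ ρ' i
  ν-⇔ _ _ h i = mk⇔ (λ { (X , post , Xi) → X , (λ j Xj → to (h X j) (post j Xj)) , Xi })
                (λ { (X , post , Xi) → X , (λ j Xj → from (h X j) (post j Xj)) , Xi })

  rename-sem : ∀ {m k} (φ : Formula A m) (r : Fin m → Fin k) {ρ : Val k} {ρ' : Val m} →
               (∀ x j → ρ (r x) j ≡ ρ' x j) → ∀ i → ⟦ rename r φ ⟧ ρ i ⇔ ⟦ φ ⟧ ρ' i
  rename-sem (var x)   r h i = ≡-true-⇔ (h x i)
  rename-sem (pos a)   r h i = ⇔-refl
  rename-sem (neg a)   r h i = ⇔-refl
  rename-sem (mod M φ) r h   = mod-⇔ M (rename-sem φ r h)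
  rename-sem (φ ∨ᶠ ψ)  r h i = rename-sem φ r h i ⊎-⇔ rename-sem ψ r h i
  rename-sem (φ ∧ᶠ ψ)  r h i = rename-sem φ r h i ×-⇔ rename-sem ψ r h i
  rename-sem (μᶠ φ)    r {ρ} h = μ-⇔ (rename _ φ) φ λ X →
    rename-sem φ _ {extend X ρ} λ { zero j → refl ; (suc x) j → h x j }
  rename-sem (νᶠ φ)    r {ρ} h = ν-⇔ (rename _ φ) φ λ X →
    rename-sem φ _ {extend X ρ} λ { zero j → refl ; (suc x) j → h x j }

  formula-≡ : ∀ {m} {φ ψ : Formula A m} {ρ i} → φ ≡ ψ → ⟦ φ ⟧ ρ i ⇔ ⟦ ψ ⟧ ρ i
  formula-≡ refl = ⇔-refl

  Realises : ∀ {m k} → (Fin m → Formula A k) → Val k → Val m → Set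
  Realises σ ρ ρ' = ∀ x j → ⟦ σ x ⟧ ρ j ⇔ (ρ' x j ≡ true)

  exts-realises : ∀ {m k} (σ : Fin m → Formula A k) {ρ ρ'} → Realises σ ρ ρ' →
                  ∀ X → Realises (exts σ) (extend X ρ) (extend X ρ')
  exts-realises σ h X zero    j = ⇔-refl
  exts-realises σ h X (suc x) j = ⇔-trans (rename-sem (σ x) suc (λ _ _ → refl) j) (h x j)

  subst-sem : ∀ {m k} (φ : Formula A m) (σ : Fin m → Formula A k) {ρ ρ'} →
              Realises σ ρ ρ' → ∀ i → ⟦ subst φ σ ⟧ ρ i ⇔ ⟦ φ ⟧ ρ' i
  subst-sem (var x)   σ h   = h x
  subst-sem (pos a)   σ h i = ⇔-refl
  subst-sem (neg a)   σ h i = ⇔-refl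
  subst-sem (mod M φ) σ h   = mod-⇔ M (subst-sem φ σ h)
  subst-sem (φ ∨ᶠ ψ)  σ h i = subst-sem φ σ h i ⊎-⇔ subst-sem ψ σ h i
  subst-sem (φ ∧ᶠ ψ)  σ h i = subst-sem φ σ h i ×-⇔ subst-sem ψ σ h i
  subst-sem (μᶠ φ)    σ h   = μ-⇔ (subst φ (exts σ)) φ λ X →
    subst-sem φ (exts σ) (exts-realises σ h X)
  subst-sem (νᶠ φ)    σ h   = ν-⇔ (subst φ (exts σ)) φ λ X →
    subst-sem φ (exts σ) (exts-realises σ h X)

TT FF : ∀ {A k} → Formula A k
TT = pos firstg ∨ᶠ neg firstg
FF = pos firstg ∧ᶠ neg firstg

Cst : ∀ {A k} → Bool → Formula A k
Cst true  = TT
Cst false = FF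

⋁ : ∀ {A n k} → (Fin n → Formula A k) → Formula A k
⋁ {n = zero}  f = FF
⋁ {n = suc n} f = f zero ∨ᶠ ⋁ (f ∘ suc)

⋁ᴹ : ∀ {A k} → (Marking → Formula A k) → Formula A k
⋁ᴹ f = (f (true , true) ∨ᶠ f (true , false)) ∨ᶠ (f (false , true) ∨ᶠ f (false , false))

lit : ∀ {A k} → Bool → Atom A → Formula A k
lit true  a = pos a
lit false a = neg a

G : ∀ {A k} → Formula A k → Formula A k
G φ = νᶠ (rename suc φ ∧ᶠ (pos lastg ∨ᶠ mod Xg (var zero)))

module DerivedSemantics {A : Set} (w : Word A) where
  open Semantics w
  open SubstitutionSemantics w using (rename-sem)

  TT-sem : ∀ {k} {ρ : Val k} {i} → ⟦ TT ⟧ ρ i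
  TT-sem {i = i} with toℕ i ℕₚ.≟ 0
  ... | yes i≡0 = inj₁ i≡0
  ... | no  i≢0 = inj₂ i≢0

  FF-sem : ∀ {k} {ρ : Val k} {i} → ¬ ⟦ FF ⟧ ρ i
  FF-sem (first , ¬first) = ¬first first

  Cst-sem : ∀ {k} {ρ : Val k} {i} b → ⟦ Cst b ⟧ ρ i ⇔ (b ≡ true)
  Cst-sem {ρ = ρ} true = mk⇔ (λ _ → refl) (λ _ → TT-sem {ρ = ρ})
  Cst-sem {ρ = ρ} false = mk⇔ (⊥-elim ∘ FF-sem {ρ = ρ}) (λ ())

  ⋁-sem : ∀ {n k} {ρ : Val k} {i} (f : Fin n → Formula A k) →
          ⟦ ⋁ f ⟧ ρ i ⇔ Σ (Fin n) λ x → ⟦ f x ⟧ ρ i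
  ⋁-sem {zero} {ρ = ρ} f = mk⇔ (⊥-elim ∘ FF-sem {ρ = ρ}) (λ ())
  ⋁-sem {suc n} {ρ = ρ} {i} f = mk⇔
    (λ { (inj₁ f0) → zero , f0 ; (inj₂ fs) → let x , fx = to rest fs in suc x , fx })
    (λ { (zero , f0) → inj₁ f0 ; (suc x , fx) → inj₂ (from rest (x , fx)) })
    where rest = ⋁-sem {ρ = ρ} {i} (f ∘ suc)

  ⋁ᴹ-sem : ∀ {k} {ρ : Val k} {i} (f : Marking → Formula A k) →
           ⟦ ⋁ᴹ f ⟧ ρ i ⇔ Σ Marking λ t → ⟦ f t ⟧ ρ i
  ⋁ᴹ-sem f = mk⇔
    (λ { (inj₁ (inj₁ x)) → _ , x ; (inj₁ (inj₂ x)) → _ , x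
       ; (inj₂ (inj₁ x)) → _ , x ; (inj₂ (inj₂ x)) → _ , x })
    (λ { ((true , true) , x) → inj₁ (inj₁ x) ; ((true , false) , x) → inj₁ (inj₂ x)
       ; ((false , true) , x) → inj₂ (inj₁ x) ; ((false , false) , x) → inj₂ (inj₂ x) })

  lit-sem : ∀ {k} {ρ : Val k} {i} b a (a? : Dec (⟦ a ⟧ᵃ i)) → ⟦ lit b a ⟧ ρ i ⇔ (b ≡ does a?)
  lit-sem true  a (yes x) = mk⇔ (λ _ → refl) (λ _ → x)
  lit-sem true  a (no ¬x) = mk⇔ (⊥-elim ∘ ¬x) (λ ())
  lit-sem false a (yes x) = mk⇔ (λ ¬x → ⊥-elim (¬x x)) (λ ())
  lit-sem false a (no ¬x) = mk⇔ (λ _ → refl) (λ _ → ¬x)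

  G-sem : ∀ {k} (φ : Formula A k) (ρ : Val k) i₀ → toℕ i₀ ≡ 0 →
          ⟦ G φ ⟧ ρ i₀ ⇔ (∀ j → ⟦ φ ⟧ ρ j)
  G-sem φ ρ i₀ i₀-first = mk⇔ everywhere (λ all → (λ _ → true) , (λ j _ → invariant all j) , refl)
    where
    weaken : ∀ X j → ⟦ rename suc φ ⟧ (extend X ρ) j ⇔ ⟦ φ ⟧ ρ j
    weaken X j = rename-sem φ suc (λ _ _ → refl) j
    -- the everywhere-true set is a postfixed point
    invariant : (∀ j → ⟦ φ ⟧ ρ j) → ∀ j →
                ⟦ rename suc φ ∧ᶠ (pos lastg ∨ᶠ mod Xg (var zero)) ⟧ (extend (λ _ → true) ρ) j
    invariant all j with suc (toℕ j) ℕₚ.<? len w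
    ... | yes j+1<n = from (weaken _ j) (all j) , inj₂ (fromℕ< j+1<n , toℕ-fromℕ< j+1<n , refl)
    ... | no  j+1≮n = from (weaken _ j) (all j) ,
                      inj₁ (ℕₚ.≤-antisym (toℕ<n j) (ℕₚ.≮⇒≥ j+1≮n))
    -- a postfixed point containing the first position contains every position
    everywhere : ⟦ G φ ⟧ ρ i₀ → ∀ j → ⟦ φ ⟧ ρ j
    everywhere (X , post , Xi₀) j = to (weaken X j) (proj₁ (post j (reach (toℕ j) j refl)))
      where
      reach : ∀ n j → toℕ j ≡ n → X j ≡ true
      reach zero j j≡0 with toℕ-injective (trans j≡0 (sym i₀-first))
      ... | refl = Xi₀
      reach (suc n) j j≡n+1 with post (fromℕ< j-1<len) (reach n (fromℕ< j-1<len) (toℕ-fromℕ< j-1<len))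
        where j-1<len = ℕₚ.<-trans (ℕₚ.≤-reflexive (sym j≡n+1)) (toℕ<n j)
      ... | _ , inj₁ last =
        ⊥-elim (ℕₚ.<-irrefl (trans j≡n+1 (trans (cong suc (sym (toℕ-fromℕ< _))) last)) (toℕ<n j))
      ... | _ , inj₂ (k , k≡n+1 , Xk)
          with toℕ-injective (trans k≡n+1 (trans (cong suc (toℕ-fromℕ< _)) (sym j≡n+1)))
      ... | refl = Xk

-- The state of a CMT at i depends on the states at
-- the global and the class neighbour of i that are read before i: the
-- predecessors for a forward CMT, the successors for a backward one.

initialᵍ initialᶜ : ∀ {A} → Direction → Atom A
initialᵍ forward  = firstg
initialᵍ backward = lastg
initialᶜ forward  = firstc
initialᶜ backward = lastc

finalᵍ finalᶜ : ∀ {A} → Direction → Atom A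
finalᵍ forward  = lastg
finalᵍ backward = firstg
finalᶜ forward  = lastc
finalᶜ backward = firstc

noMemory : ∀ {Q} → Direction → Mem Q
noMemory forward  = bot
noMemory backward = top

prevᵍ prevᶜ : Direction → Modality
prevᵍ forward  = Yg
prevᵍ backward = Xg
prevᶜ forward  = Yc
prevᶜ backward = Xc

Mods : Direction → Modality → Set
Mods forward  = PastMods
Mods backward = FutureMods

prevᵍ-Mods : ∀ d → Mods d (prevᵍ d)
prevᵍ-Mods forward  = tt
prevᵍ-Mods backward = tt

prevᶜ-Mods : ∀ d → Mods d (prevᶜ d)
prevᶜ-Mods forward  = tt
prevᶜ-Mods backward = tt

Mods-BR : ∀ {A n} d {ψ : Formula A n} → Formulas (Mods d) ψ → BRbase ψ
Mods-BR forward  = inj₂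
Mods-BR backward = inj₁

module ReadingOrder {A : Set} (w : Word A) where
  open Positions w
  open Semantics w

  SuccG? : ∀ i j → Dec (SuccG i j)
  SuccG? i j = toℕ j ℕₚ.≟ suc (toℕ i)

  ClassSucc? : ∀ i j → Dec (ClassSucc i j)
  ClassSucc? i j =
    (toℕ i <? toℕ j) ×-dec (dat w j ℕₚ.≟ dat w i) ×-dec
    all? (λ k → (toℕ i <? toℕ k) →-dec (toℕ k <? toℕ j) →-dec ¬? (dat w k ℕₚ.≟ dat w i))

  SAt? : ∀ i → Dec (SAt i)
  SAt? i = any? λ j → SuccG? i j ×-dec ClassSucc? i j

  PAt? : ∀ i → Dec (PAt i)
  PAt? i = any? λ j → SuccG? j i ×-dec ClassSucc? j i

  classSucc-unique : ∀ {i j j'} → ClassSucc i j → ClassSucc i j' → j ≡ j'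
  classSucc-unique {j = j} {j'} (i<j , same , gap) (i<j' , same' , gap') with ℕₚ.<-cmp (toℕ j) (toℕ j')
  ... | tri< j<j' _ _ = ⊥-elim (gap' j i<j j<j' same)
  ... | tri≈ _ j≡j' _ = toℕ-injective j≡j'
  ... | tri> _ _ j'<j = ⊥-elim (gap j' i<j' j'<j same')

  classPred-unique : ∀ {i j j'} → ClassSucc j i → ClassSucc j' i → j ≡ j'
  classPred-unique {j = j} {j'} (j<i , same , gap) (j'<i , same' , gap') with ℕₚ.<-cmp (toℕ j) (toℕ j')
  ... | tri< j<j' _ _ = ⊥-elim (gap j' j<j' j'<i (trans (sym same') same))
  ... | tri≈ _ j≡j' _ = toℕ-injective j≡j'
  ... | tri> _ _ j'<j = ⊥-elim (gap' j j'<j j<i (trans (sym same) same'))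

  Prevᵍ Prevᶜ : Direction → Pos → Pos → Set
  Prevᵍ forward  i j = SuccG j i
  Prevᵍ backward i j = SuccG i j
  Prevᶜ forward  i j = ClassSucc j i
  Prevᶜ backward i j = ClassSucc i j

  Earlier : Direction → Pos → Pos → Set
  Earlier forward  i j = toℕ j < toℕ i
  Earlier backward i j = toℕ i < toℕ j

  prevᵍ? : ∀ d i j → Dec (Prevᵍ d i j)
  prevᵍ? forward  i j = SuccG? j i
  prevᵍ? backward i j = SuccG? i j

  prevᶜ? : ∀ d i j → Dec (Prevᶜ d i j)
  prevᶜ? forward  i j = ClassSucc? j i
  prevᶜ? backward i j = ClassSucc? i j

  prevᵍ-earlier : ∀ d {i j} → Prevᵍ d i j → Earlier d i j
  prevᵍ-earlier forward  i≡j+1 = ℕₚ.≤-reflexive (sym i≡j+1)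
  prevᵍ-earlier backward i+1≡j = ℕₚ.≤-reflexive (sym i+1≡j)

  prevᶜ-earlier : ∀ d {i j} → Prevᶜ d i j → Earlier d i j
  prevᶜ-earlier forward  = proj₁
  prevᶜ-earlier backward = proj₁

  prevᵍ-unique : ∀ d {i j j'} → Prevᵍ d i j → Prevᵍ d i j' → j ≡ j'
  prevᵍ-unique forward  i≡j+1 i≡j'+1 = toℕ-injective (ℕₚ.suc-injective (trans (sym i≡j+1) i≡j'+1))
  prevᵍ-unique backward j≡i+1 j'≡i+1 = toℕ-injective (trans j≡i+1 (sym j'≡i+1))

  prevᶜ-unique : ∀ d {i j j'} → Prevᶜ d i j → Prevᶜ d i j' → j ≡ j'
  prevᶜ-unique forward  = classPred-unique
  prevᶜ-unique backward = classSucc-unique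

  earlier-trans : ∀ d {i j k} → Earlier d i j → Earlier d j k → Earlier d i k
  earlier-trans forward  j<i k<j = ℕₚ.<-trans k<j j<i
  earlier-trans backward i<j j<k = ℕₚ.<-trans i<j j<k

  earlier-wf : ∀ d → WellFounded (λ j i → Earlier d i j)
  earlier-wf forward  = <-wellFounded
  earlier-wf backward = >-wellFounded

  prevᵍ-sem : ∀ {k} {ρ : Val k} {i} d φ →
              ⟦ mod (prevᵍ d) φ ⟧ ρ i ⇔ Σ Pos λ j → Prevᵍ d i j × ⟦ φ ⟧ ρ j
  prevᵍ-sem forward  φ = ⇔-refl
  prevᵍ-sem backward φ = ⇔-refl

  prevᶜ-sem : ∀ {k} {ρ : Val k} {i} d φ →
              ⟦ mod (prevᶜ d) φ ⟧ ρ i ⇔ Σ Pos λ j → Prevᶜ d i j × ⟦ φ ⟧ ρ j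
  prevᶜ-sem forward  φ = ⇔-refl
  prevᶜ-sem backward φ = ⇔-refl

  initialᶜ-⇔ : ∀ d i → ⟦ initialᶜ d ⟧ᵃ i ⇔ (¬ Σ Pos λ j → Prevᶜ d i j)
  initialᶜ-⇔ forward  i = ⇔-refl
  initialᶜ-⇔ backward i = ⇔-refl

  initialᵍ-⇔ : ∀ d i → ⟦ initialᵍ d ⟧ᵃ i ⇔ (¬ Σ Pos λ j → Prevᵍ d i j)
  initialᵍ-⇔ forward i = mk⇔ (λ { i≡0 (j , i≡j+1) → ℕₚ.0≢1+n (trans (sym i≡0) i≡j+1) }) first
    where
    first : (¬ Σ Pos λ j → SuccG j i) → toℕ i ≡ 0
    first none with toℕ i in i≡
    ... | zero  = refl
    ... | suc n = ⊥-elim (none (fromℕ< n<len , cong suc (sym (toℕ-fromℕ< n<len))))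
      where n<len = ℕₚ.<-trans (ℕₚ.n<1+n n) (ℕₚ.≤-trans (ℕₚ.≤-reflexive (cong suc (sym i≡))) (toℕ<n i))
  initialᵍ-⇔ backward i = mk⇔ (λ { last (j , j≡i+1) → ℕₚ.<-irrefl (trans j≡i+1 last) (toℕ<n j) }) last
    where
    last : (¬ Σ Pos λ j → SuccG i j) → suc (toℕ i) ≡ len w
    last none with suc (toℕ i) ℕₚ.<? len w
    ... | yes i+1<len = ⊥-elim (none (fromℕ< i+1<len , toℕ-fromℕ< i+1<len))
    ... | no  i+1≮len = ℕₚ.≤-antisym (toℕ<n i) (ℕₚ.≮⇒≥ i+1≮len)

  finalᵍ? : ∀ d i → Dec (⟦ finalᵍ d ⟧ᵃ i)
  finalᵍ? forward  i = suc (toℕ i) ℕₚ.≟ len w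
  finalᵍ? backward i = toℕ i ℕₚ.≟ 0

  finalᶜ? : ∀ d i → Dec (⟦ finalᶜ d ⟧ᵃ i)
  finalᶜ? forward  i = ¬? (any? (ClassSucc? i))
  finalᶜ? backward i = ¬? (any? λ j → ClassSucc? j i)

_==_ : ∀ {n} → Fin n → Fin n → Bool
x == y = does (x ≟ y)

-- Formulas L s x meaning "the letter here is x": they have m outer variables,
-- preceded by s variables to be bound by the fixpoints of the encoding.
LabelFormulas : Set → ℕ → ℕ → Set
LabelFormulas A a m = ∀ s → Fin a → Formula A (s + m)

-- The formulas describing the run of a CMT reading in direction d the letters
-- described by L.  Below, F q is a formula meaning "the state after this
-- position is q".
module Encoding {A : Set} {a b : ℕ} (d : Direction) (T : CMT a b) {m : ℕ}
                (L : LabelFormulas A a m) where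
  open CMT T

  Condition : Set
  Condition = Fin nQ → Mem (Fin nQ) → Fin a → Marking → Bool

  leadsTo : Fin nQ → Condition
  leadsTo q q' mm x t = q == proj₁ (Δ q' mm x t)

  outputs : Fin b → Condition
  outputs o q' mm x t = o == proj₂ (Δ q' mm x t)

  Before : ∀ {s} → (Fin nQ → Formula A (s + m)) → Fin nQ → Formula A (s + m)
  Before F q' = (pos (initialᵍ d) ∧ᶠ Cst (q' == q₀)) ∨ᶠ mod (prevᵍ d) (F q')

  Memory : ∀ {s} → (Fin nQ → Formula A (s + m)) → (Mem (Fin nQ) → Bool) → Formula A (s + m)
  Memory F cc = (pos (initialᶜ d) ∧ᶠ Cst (cc (noMemory d)))
              ∨ᶠ ⋁ λ q → mod (prevᶜ d) (F q) ∧ᶠ Cst (cc (st q))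

  Guard : ∀ s → Fin a → Marking → Formula A (s + m)
  Guard s x (p , t) = L s x ∧ᶠ (lit p P ∧ᶠ lit t S)

  Here : ∀ s → Condition → (Fin nQ → Formula A (s + m)) → Fin nQ → Fin a → Marking → Formula A (s + m)
  Here s c F q' x t = Guard s x t ∧ᶠ Memory F (λ mm → c q' mm x t)

  Step : ∀ s → Condition → (Fin nQ → Formula A (s + m)) → Formula A (s + m)
  Step s c F = ⋁ λ q' → Before F q' ∧ᶠ (⋁ λ x → ⋁ᴹ (Here s c F q' x))

  -- Bekić's solution of the system  X_q = Step (leadsTo q) X  by nested
  -- least fixpoints: variable k is bound to X_(stack k); a state already on
  -- the stack is referred to by its variable, otherwise a new fixpoint is
  -- opened.  Fuel nQ never runs out, as the stack holds distinct states.
  State : ℕ → ∀ {s} → Vec (Fin nQ) s → Fin nQ → Formula A (s + m)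
  State fuel stack q with any? (λ k → lookup stack k ≟ q)
  ... | yes (k , _) = var (k ↑ˡ m)
  State zero             stack q | no _ = FF
  State (suc fuel) {s} stack q | no _ = μᶠ (Step (suc s) (leadsTo q) (State fuel (q ∷ stack)))

  StateF : Fin nQ → Formula A m
  StateF q = State nQ [] q

  OutputF : Fin b → Formula A m
  OutputF o = Step 0 (outputs o) StateF

-- with the states as variables: wherever atom a holds, the state lies in F
Always : ∀ {A n} → Atom A → (Fin n → Bool) → Formula A n
Always a F = G (neg a ∨ᶠ ⋁ λ q → var q ∧ᶠ Cst (F q))

Acceptance : ∀ {A a b} → Direction → (T : CMT a b) → Formula A (CMT.nQ T)
Acceptance d T = Always (finalᵍ d) (CMT.Fg T) ∧ᶠ Always (finalᶜ d) (CMT.Fc T)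

module _ {A : Set} {M : Modality → Set} where

  rename-frag : ∀ {m k} (φ : Formula A m) (r : Fin m → Fin k) →
                Formulas M φ → Formulas M (rename r φ)
  rename-frag (var x)   r h         = tt
  rename-frag (pos a)   r h         = tt
  rename-frag (neg a)   r h         = tt
  rename-frag (mod N φ) r (hN , hφ) = hN , rename-frag φ r hφ
  rename-frag (φ ∨ᶠ ψ)  r (hφ , hψ) = rename-frag φ r hφ , rename-frag ψ r hψ
  rename-frag (φ ∧ᶠ ψ)  r (hφ , hψ) = rename-frag φ r hφ , rename-frag ψ r hψ
  rename-frag (μᶠ φ)    r h         = rename-frag φ _ h
  rename-frag (νᶠ φ)    r h         = rename-frag φ _ h

  Cst-frag : ∀ {k} b → Formulas M (Cst {A} {k} b)
  Cst-frag true  = tt , tt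
  Cst-frag false = tt , tt

  ⋁-frag : ∀ {n k} (f : Fin n → Formula A k) → (∀ x → Formulas M (f x)) → Formulas M (⋁ f)
  ⋁-frag {zero}  f h = tt , tt
  ⋁-frag {suc n} f h = h zero , ⋁-frag (λ x → f (suc x)) (λ x → h (suc x))

  ⋁ᴹ-frag : ∀ {k} (f : Marking → Formula A k) → (∀ t → Formulas M (f t)) → Formulas M (⋁ᴹ f)
  ⋁ᴹ-frag f h = (h _ , h _) , (h _ , h _)

  lit-frag : ∀ {k} b a → Formulas M (lit {A} {k} b a)
  lit-frag true  a = tt
  lit-frag false a = tt

module EncodingFragment {A : Set} {a b : ℕ} (d : Direction) (T : CMT a b) {m : ℕ}
                        (L : LabelFormulas A a m) (L-frag : ∀ s x → Formulas (Mods d) (L s x)) where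
  open Encoding d T L
  open CMT T

  step-frag : ∀ s c (F : Fin nQ → Formula A (s + m)) →
              (∀ q → Formulas (Mods d) (F q)) → Formulas (Mods d) (Step s c F)
  step-frag s c F F-frag =
    ⋁-frag _ λ q' → before-frag q' , ⋁-frag _ λ x → ⋁ᴹ-frag (Here s c F q' x) λ t →
      guard-frag x t , memory-frag (λ mm → c q' mm x t)
    where
    before-frag : ∀ q' → Formulas (Mods d) (Before F q')
    before-frag q' = (tt , Cst-frag (q' == q₀)) , prevᵍ-Mods d , F-frag q'
    guard-frag : ∀ x t → Formulas (Mods d) (Guard s x t)
    guard-frag x (p , t) = L-frag s x , lit-frag p P , lit-frag t S
    memory-frag : ∀ cc → Formulas (Mods d) (Memory F cc)
    memory-frag cc = (tt , Cst-frag (cc (noMemory d))) ,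
                     ⋁-frag (λ q → mod (prevᶜ d) (F q) ∧ᶠ Cst (cc (st q)))
                            (λ q → (prevᶜ-Mods d , F-frag q) , Cst-frag (cc (st q)))

  state-frag : ∀ fuel {s} (stack : Vec (Fin nQ) s) q → Formulas (Mods d) (State fuel stack q)
  state-frag fuel stack q with any? (λ k → lookup stack k ≟ q)
  ... | yes _ = tt
  state-frag zero       stack q | no _ = tt , tt
  state-frag (suc fuel) stack q | no _ = step-frag _ (leadsTo q) _ (state-frag fuel (q ∷ stack))

  stateF-frag : ∀ q → Formulas (Mods d) (StateF q)
  stateF-frag = state-frag nQ []

  outputF-frag : ∀ o → Formulas (Mods d) (OutputF o)
  outputF-frag o = step-frag 0 (outputs o) StateF stateF-frag

G-frag : ∀ {A k} (φ : Formula A k) → Formulas FutureMods φ → Formulas FutureMods (G φ)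
G-frag φ h = rename-frag φ suc h , tt , tt , tt

always-frag : ∀ {A n} a (F : Fin n → Bool) → Formulas FutureMods (Always {A} a F)
always-frag a F = G-frag (neg a ∨ᶠ ⋁ λ q → var q ∧ᶠ Cst (F q))
                         (tt , ⋁-frag (λ q → var q ∧ᶠ Cst (F q)) λ q → tt , Cst-frag (F q))

acceptance-frag : ∀ {A a b} d (T : CMT a b) → Formulas FutureMods (Acceptance {A} d T)
acceptance-frag d T = always-frag (finalᵍ d) (CMT.Fg T) , always-frag (finalᶜ d) (CMT.Fc T)

module Run {A : Set} (w : Word A) {a b : ℕ} (d : Direction) (T : CMT a b)
           (lab' : Fin (len w) → Fin a) where
  open Semantics w
  open ReadingOrder w
  open CMT T
  module R = Runs (relabel w lab') T

  tp : Pos → Marking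
  tp i = does (PAt? i) , does (SAt? i)

  type-⇔ : ∀ i t → R.TypeIs i t ⇔ (t ≡ tp i)
  type-⇔ i (p , s) = ⇔-trans (reflects-⇔ (PAt? i) p ×-⇔ reflects-⇔ (SAt? i) s) pair-⇔

  BeforeRel : (Fin nQ → Pos → Set) → Pos → Fin nQ → Set
  BeforeRel Pr i q = (⟦ initialᵍ d ⟧ᵃ i × q ≡ q₀) ⊎ Σ Pos λ j → Prevᵍ d i j × Pr q j

  MemoryRel : (Mem (Fin nQ) → Pos → Set) → Pos → Mem (Fin nQ) → Set
  MemoryRel Mm i mm = (mm ≡ noMemory d × ⟦ initialᶜ d ⟧ᵃ i) ⊎ Σ Pos λ j → Prevᶜ d i j × Mm mm j

  Graph : (Pos → Fin nQ) → Fin nQ → Pos → Set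
  Graph g q j = q ≡ g j

  Stored : (Pos → Fin nQ) → Mem (Fin nQ) → Pos → Set
  Stored g mm j = mm ≡ st (g j)

  EarlierStates : Pos → Set
  EarlierStates i = ∀ {j} → Earlier d i j → Fin nQ

  _↾_ : (Pos → Fin nQ) → (i : Pos) → EarlierStates i
  (g ↾ i) {j} _ = g j

  before : ∀ i → EarlierStates i → Fin nQ
  before i f with any? (prevᵍ? d i)
  ... | yes (j , j-prev) = f (prevᵍ-earlier d j-prev)
  ... | no  _            = q₀

  memory : ∀ i → EarlierStates i → Mem (Fin nQ)
  memory i f with any? (prevᶜ? d i)
  ... | yes (j , j-prev) = st (f (prevᶜ-earlier d j-prev))
  ... | no  _            = noMemory d

  transition : ∀ i → EarlierStates i → Fin nQ × Fin b
  transition i f = Δ (before i f) (memory i f) (lab' i) (tp i)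

  transition-ext : ∀ i {f f' : EarlierStates i} → (∀ {j} (e : Earlier d i j) → f e ≡ f' e) →
                   transition i f ≡ transition i f'
  transition-ext i {f} {f'} f≗f' = cong₂ (λ q mm → Δ q mm (lab' i) (tp i)) before-ext memory-ext
    where
    before-ext : before i f ≡ before i f'
    before-ext with any? (prevᵍ? d i)
    ... | yes (j , j-prev) = f≗f' (prevᵍ-earlier d j-prev)
    ... | no  _            = refl
    memory-ext : memory i f ≡ memory i f'
    memory-ext with any? (prevᶜ? d i)
    ... | yes (j , j-prev) = cong st (f≗f' (prevᶜ-earlier d j-prev))
    ... | no  _            = refl

  before-graph : ∀ g i q → BeforeRel (Graph g) i q ⇔ (q ≡ before i (g ↾ i))
  before-graph g i q with any? (prevᵍ? d i)
  ... | yes (j , j-prev) = mk⇔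
    (λ { (inj₁ (init , _)) → ⊥-elim (to (initialᵍ-⇔ d i) init (j , j-prev))
       ; (inj₂ (j' , j'-prev , q≡)) → trans q≡ (cong g (prevᵍ-unique d j'-prev j-prev)) })
    (λ q≡ → inj₂ (j , j-prev , q≡))
  ... | no none = mk⇔
    (λ { (inj₁ (_ , q≡q₀)) → q≡q₀ ; (inj₂ (j' , j'-prev , _)) → ⊥-elim (none (j' , j'-prev)) })
    (λ q≡q₀ → inj₁ (from (initialᵍ-⇔ d i) none , q≡q₀))

  memory-graph : ∀ g i mm → MemoryRel (Stored g) i mm ⇔ (mm ≡ memory i (g ↾ i))
  memory-graph g i mm with any? (prevᶜ? d i)
  ... | yes (j , j-prev) = mk⇔
    (λ { (inj₁ (_ , init)) → ⊥-elim (to (initialᶜ-⇔ d i) init (j , j-prev))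
       ; (inj₂ (j' , j'-prev , mm≡)) →
           trans mm≡ (cong (λ j → st (g j)) (prevᶜ-unique d j'-prev j-prev)) })
    (λ mm≡ → inj₂ (j , j-prev , mm≡))
  ... | no none = mk⇔
    (λ { (inj₁ (mm≡ , _)) → mm≡ ; (inj₂ (j' , j'-prev , _)) → ⊥-elim (none (j' , j'-prev)) })
    (λ mm≡ → inj₁ (mm≡ , from (initialᶜ-⇔ d i) none))

  private
    step : ∀ i → EarlierStates i → Fin nQ
    step i f = proj₁ (transition i f)

  run : Pos → Fin nQ
  run = All.wfRec (earlier-wf d) 0ℓ (λ _ → Fin nQ) step

  run-unfold : ∀ i → run i ≡ proj₁ (transition i (run ↾ i))
  run-unfold i = FixPoint.unfold-wfRec (earlier-wf d) (λ _ → Fin nQ) step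
                   (λ i f≗f' → cong proj₁ (transition-ext i f≗f'))

  out : Pos → Fin b
  out i = proj₂ (transition i (run ↾ i))

  -- the run as a valuation of variables standing for the states
  ρRun : Val nQ
  ρRun q j = q == run j

  run-unique : ∀ g → (∀ i → g i ≡ proj₁ (transition i (g ↾ i))) → ∀ i → g i ≡ run i
  run-unique g follows = All.wfRec (earlier-wf d) 0ℓ (λ i → g i ≡ run i) λ i g≗run →
    trans (follows i) (trans (cong proj₁ (transition-ext i g≗run)) (sym (run-unfold i)))

  Local : (Pos → Fin nQ) → (Pos → Fin b) → Set
  Local g o = ∀ i q mm t → BeforeRel (Graph g) i q → MemoryRel (Stored g) i mm → R.TypeIs i t →
              Δ q mm (lab' i) t ≡ (g i , o i)

  FinalG : (Pos → Fin nQ) → Set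
  FinalG g = ∀ q → ((len w ≡ 0 × q ≡ q₀) ⊎ Σ Pos λ j → ⟦ finalᵍ d ⟧ᵃ j × q ≡ g j) → Fg q ≡ true

  FinalC : (Pos → Fin nQ) → Set
  FinalC g = ∀ i → ⟦ finalᶜ d ⟧ᵃ i → Fc (g i) ≡ true

  local-⇔ : ∀ g o → Local g o ⇔ (∀ i → transition i (g ↾ i) ≡ (g i , o i))
  local-⇔ g o = mk⇔
    (λ local i → local i _ _ _ (from (before-graph g i _) refl) (from (memory-graph g i _) refl)
                              (from (type-⇔ i _) refl))
    (λ follows i q mm t before-i memory-i type-i →
       transition-at follows (to (before-graph g i q) before-i) (to (memory-graph g i mm) memory-i)
                     (to (type-⇔ i t) type-i))
    where
    transition-at : ∀ {i q mm t} → (∀ i → transition i (g ↾ i) ≡ (g i , o i)) →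
                    q ≡ before i (g ↾ i) → mm ≡ memory i (g ↾ i) → t ≡ tp i →
                    Δ q mm (lab' i) t ≡ (g i , o i)
    transition-at follows refl refl refl = follows _

  Accepting : Set
  Accepting = (∀ j → ⟦ finalᵍ d ⟧ᵃ j → Fg (run j) ≡ true) ×
              (∀ j → ⟦ finalᶜ d ⟧ᵃ j → Fc (run j) ≡ true)

successful-⇔ : ∀ {A} (w : Word A) {a b} d (T : CMT a b) lab' g o →
               Runs.Successful (relabel w lab') T d g o ⇔
               (Run.Local w d T lab' g o × Run.FinalG w d T lab' g × Run.FinalC w d T lab' g)
successful-⇔ w forward  T lab' g o = ⇔-refl
successful-⇔ w backward T lab' g o = ⇔-refl

module RunCharacterisation {A : Set} (w : Word A) {a b : ℕ} (d : Direction) (T : CMT a b)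
                           (lab' : Fin (len w) → Fin a) where
  open Semantics w
  open Run w d T lab'
  open CMT T

  -- on a nonempty word (given a position), T has a successful run with output o
  -- iff the run is accepting and o is its output
  runsTo-⇔ : Pos → ∀ o → R.RunsTo d o ⇔ (Accepting × (∀ i → o i ≡ out i))
  runsTo-⇔ i₀ o = mk⇔ to-run from-run
    where
    to-run : R.RunsTo d o → Accepting × (∀ i → o i ≡ out i)
    to-run (g , successful) = (finalG , finalC) , o≗out
      where
      conditions = to (successful-⇔ w d T lab' g o) successful
      follows = to (local-⇔ g o) (proj₁ conditions)
      g≗run = run-unique g (λ i → cong proj₁ (sym (follows i)))
      finalG : ∀ j → ⟦ finalᵍ d ⟧ᵃ j → Fg (run j) ≡ true
      finalG j fin = proj₁ (proj₂ conditions) (run j) (inj₂ (j , fin , sym (g≗run j)))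
      finalC : ∀ j → ⟦ finalᶜ d ⟧ᵃ j → Fc (run j) ≡ true
      finalC j fin = trans (cong Fc (sym (g≗run j))) (proj₂ (proj₂ conditions) j fin)
      o≗out : ∀ i → o i ≡ out i
      o≗out i = trans (cong proj₂ (sym (follows i))) (cong proj₂ (transition-ext i λ {j} _ → g≗run j))
    from-run : Accepting × (∀ i → o i ≡ out i) → R.RunsTo d o
    from-run ((finalG , finalC) , o≗out) =
      run , from (successful-⇔ w d T lab' run o) (from (local-⇔ run o) follows , finalG' , finalC)
      where
      follows : ∀ i → transition i (run ↾ i) ≡ (run i , o i)
      follows i = cong₂ _,_ (sym (run-unfold i)) (sym (o≗out i))
      finalG' : FinalG run
      finalG' q (inj₁ (empty , _))     = ⊥-elim (ℕₚ.n≮0 (ℕₚ.<-≤-trans (toℕ<n i₀) (ℕₚ.≤-reflexive empty)))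
      finalG' q (inj₂ (j , fin , refl)) = finalG j fin

injective-covers : ∀ {n} (v : Vec (Fin n) n) → Injective _≡_ _≡_ (lookup v) →
                   ∀ q → Σ (Fin n) λ k → lookup v k ≡ q
injective-covers {n} v inj q with any? (λ k → lookup v k ≟ q)
... | yes found = found
... | no  missing with pigeonhole (ℕₚ.n<1+n n) extended
  where
  extended : Fin (suc n) → Fin n
  extended zero    = q
  extended (suc k) = lookup v k
... | zero  , zero  , () , _
... | zero  , suc k , _  , q≡vk = ⊥-elim (missing (k , sym q≡vk))
... | suc k , zero  , () , _
... | suc k , suc l , k<l , vk≡vl with inj vk≡vl
... | refl = ⊥-elim (ℕₚ.<-irrefl refl k<l)

push-injective : ∀ {n s} (stack : Vec (Fin n) s) q → Injective _≡_ _≡_ (lookup stack) →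
                 ¬ (Σ (Fin s) λ k → lookup stack k ≡ q) → Injective _≡_ _≡_ (lookup (q ∷ stack))
push-injective stack q inj missing {zero}  {zero}  _     = refl
push-injective stack q inj missing {zero}  {suc l} q≡vl  = ⊥-elim (missing (l , sym q≡vl))
push-injective stack q inj missing {suc k} {zero}  vk≡q  = ⊥-elim (missing (k , vk≡q))
push-injective stack q inj missing {suc k} {suc l} vk≡vl = cong suc (inj vk≡vl)

Extends : ∀ {A} (w : Word A) {m} s → Semantics.Val w (s + m) → Semantics.Val w m → Set
Extends w s ρ ρL = ∀ x j → ρ (s ↑ʳ x) j ≡ ρL x j

Defines : ∀ {A} (w : Word A) {a m} → LabelFormulas A a m → Semantics.Val w m →
          (Fin (len w) → Fin a) → Set
Defines w L ρL lab' = ∀ s ρ → Extends w s ρ ρL → ∀ x j → Semantics.⟦_⟧ w (L s x) ρ j ⇔ (lab' j ≡ x)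

module LevelSemantics {A : Set} (w : Word A) {a b : ℕ} (d : Direction) (T : CMT a b)
                      (lab' : Fin (len w) → Fin a) {m : ℕ} (L : LabelFormulas A a m)
                      (ρL : Semantics.Val w m) (L-defines : Defines w L ρL lab') where
  open Semantics w
  open ReadingOrder w
  open DerivedSemantics w
  open Run w d T lab'
  open Encoding d T L
  open CMT T

  StoredIn : (Fin nQ → Pos → Set) → Mem (Fin nQ) → Pos → Set
  StoredIn Pr mm j = Σ (Fin nQ) λ q → mm ≡ st q × Pr q j

  StepRel : Condition → (Fin nQ → Pos → Set) → Pos → Set
  StepRel c Pr i = Σ (Fin nQ) λ q' → BeforeRel Pr i q' ×
                   Σ (Mem (Fin nQ)) λ mm → MemoryRel (StoredIn Pr) i mm × c q' mm (lab' i) (tp i) ≡ true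

  before-sem : ∀ {s} {ρ : Val (s + m)} F i q' →
               ⟦ Before F q' ⟧ ρ i ⇔ BeforeRel (λ q j → ⟦ F q ⟧ ρ j) i q'
  before-sem {ρ = ρ} F i q' =
    (⇔-refl ×-⇔ ⇔-trans (Cst-sem {ρ = ρ} (q' == q₀)) (does-true-⇔ (q' ≟ q₀))) ⊎-⇔ prevᵍ-sem d (F q')

  memory-sem : ∀ {s} {ρ : Val (s + m)} F cc i →
               ⟦ Memory F cc ⟧ ρ i ⇔
               Σ (Mem (Fin nQ)) λ mm → MemoryRel (StoredIn λ q j → ⟦ F q ⟧ ρ j) i mm × cc mm ≡ true
  memory-sem {ρ = ρ} F cc i = mk⇔
    (λ { (inj₁ (init , c)) → noMemory d , inj₁ (refl , init) , to (Cst-sem {ρ = ρ} _) c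
       ; (inj₂ stored) → let q , (j , j-prev , Fqj) , c = to prev stored
                         in st q , inj₂ (j , j-prev , q , refl , Fqj) , to (Cst-sem {ρ = ρ} _) c })
    (λ { (_ , inj₁ (refl , init) , c) → inj₁ (init , from (Cst-sem {ρ = ρ} _) c)
       ; (_ , inj₂ (j , j-prev , q , refl , Fqj) , c) →
           inj₂ (from prev (q , (j , j-prev , Fqj) , from (Cst-sem {ρ = ρ} _) c)) })
    where
    prev = ⇔-trans (⋁-sem {ρ = ρ} {i} (λ q → mod (prevᶜ d) (F q) ∧ᶠ Cst (cc (st q))))
                   (Σ-⇔ λ q → prevᶜ-sem d (F q) ×-⇔ ⇔-refl)

  guard-sem : ∀ {s} {ρ : Val (s + m)} → Extends w s ρ ρL → ∀ x t i →
              ⟦ Guard s x t ⟧ ρ i ⇔ (x ≡ lab' i × t ≡ tp i)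
  guard-sem {s} {ρ} ext x (p , t) i =
    ⇔-trans (L-defines s ρ ext x i) (mk⇔ sym sym) ×-⇔
    ⇔-trans (lit-sem {ρ = ρ} p P (PAt? i) ×-⇔ lit-sem {ρ = ρ} t S (SAt? i)) pair-⇔

  step-sem : ∀ {s} {ρ : Val (s + m)} → Extends w s ρ ρL → ∀ c F i →
             ⟦ Step s c F ⟧ ρ i ⇔ StepRel c (λ q j → ⟦ F q ⟧ ρ j) i
  step-sem {s} {ρ} ext c F i = ⇔-trans (⋁-sem {ρ = ρ} {i} _) (Σ-⇔ λ q' → before-sem F i q' ×-⇔ here q')
    where
    here : ∀ q' → ⟦ ⋁ (λ x → ⋁ᴹ (Here s c F q' x)) ⟧ ρ i ⇔
           Σ (Mem (Fin nQ)) λ mm → MemoryRel (StoredIn λ q j → ⟦ F q ⟧ ρ j) i mm ×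
                                   c q' mm (lab' i) (tp i) ≡ true
    here q' = ⇔-trans (⋁-sem {ρ = ρ} {i} _) (⇔-trans
      (Σ-⇔ λ x → ⇔-trans (⋁ᴹ-sem {ρ = ρ} {i} (Here s c F q' x))
                          (Σ-⇔ λ t → guard-sem ext x t i ×-⇔ memory-sem F (λ mm → c q' mm x t) i))
      contract₂)

  step-mono : ∀ {c Pr Pr' i} → (∀ q j → Earlier d i j → Pr q j → Pr' q j) →
              StepRel c Pr i → StepRel c Pr' i
  step-mono {Pr = Pr} {Pr'} {i} Pr⊆Pr' (q' , before-i , mm , memory-i , c) =
    q' , mono-before before-i , mm , mono-memory memory-i , c
    where
    mono-before : BeforeRel Pr i q' → BeforeRel Pr' i q'
    mono-before (inj₁ init)             = inj₁ init
    mono-before (inj₂ (j , j-prev , Prj)) = inj₂ (j , j-prev , Pr⊆Pr' q' j (prevᵍ-earlier d j-prev) Prj)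
    mono-memory : MemoryRel (StoredIn Pr) i mm → MemoryRel (StoredIn Pr') i mm
    mono-memory (inj₁ init) = inj₁ init
    mono-memory (inj₂ (j , j-prev , q , mm≡ , Prj)) =
      inj₂ (j , j-prev , q , mm≡ , Pr⊆Pr' q j (prevᶜ-earlier d j-prev) Prj)

  step-graph : ∀ c g i →
               StepRel c (Graph g) i ⇔ (c (before i (g ↾ i)) (memory i (g ↾ i)) (lab' i) (tp i) ≡ true)
  step-graph c g i = ⇔-trans
    (Σ-⇔ λ q' → before-graph g i q' ×-⇔ Σ-⇔ λ mm →
       ⇔-trans (⇔-refl ⊎-⇔ Σ-⇔ λ j → ⇔-refl ×-⇔ stored) (memory-graph g i mm) ×-⇔ ⇔-refl)
    (⇔-trans (Σ-⇔ λ q' → ⇔-refl ×-⇔ contract) contract)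
    where
    stored : ∀ {mm j} → StoredIn (Graph g) mm j ⇔ Stored g mm j
    stored {j = j} = mk⇔ (λ { (_ , mm≡ , refl) → mm≡ }) (λ mm≡ → g j , mm≡ , refl)

  state-step : ∀ q i → StepRel (leadsTo q) (Graph run) i ⇔ (q ≡ run i)
  state-step q i = ⇔-trans (step-graph (leadsTo q) run i) (⇔-trans (does-true-⇔ (q ≟ _))
                     (mk⇔ (λ q≡ → trans q≡ (sym (run-unfold i))) (λ q≡ → trans q≡ (run-unfold i))))

  output-step : ∀ o i → StepRel (outputs o) (Graph run) i ⇔ (o ≡ out i)
  output-step o i = ⇔-trans (step-graph (outputs o) run i) (does-true-⇔ (o ≟ _))

  StackSound : ∀ {s} → Vec (Fin nQ) s → Val (s + m) → Set
  StackSound stack ρ = ∀ k j → ρ (k ↑ˡ m) j ≡ true → lookup stack k ≡ run j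

  StackComplete : ∀ {s} → (Pos → Set) → Vec (Fin nQ) s → Val (s + m) → Set
  StackComplete U stack ρ = ∀ k j → U j → lookup stack k ≡ run j → ρ (k ↑ˡ m) j ≡ true

  Closed : (Pos → Set) → Set
  Closed U = ∀ {i j} → U i → Earlier d i j → U j

  -- soundness: the fixpoint for q contains only positions where the run is in q,
  -- as the latter set is a prefixed point
  state-sound : ∀ fuel {s} (stack : Vec (Fin nQ) s) {ρ} → Extends w s ρ ρL → StackSound stack ρ →
                ∀ q j → ⟦ State fuel stack q ⟧ ρ j → q ≡ run j
  state-sound fuel stack ext sound q j holds with any? (λ k → lookup stack k ≟ q)
  ... | yes (k , k≡q) = trans (sym k≡q) (sound k j holds)
  state-sound zero       stack {ρ} ext sound q j holds | no _ = ⊥-elim (FF-sem {ρ = ρ} holds)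
  state-sound (suc fuel) stack {ρ} ext sound q j holds | no _ =
    to (does-true-⇔ (q ≟ run j)) (holds (ρRun q) prefixed)
    where
    sound' : StackSound (q ∷ stack) (extend (ρRun q) ρ)
    sound' zero    j' = to (does-true-⇔ (q ≟ run j'))
    sound' (suc k)    = sound k
    prefixed : ∀ j' → ⟦ Step _ (leadsTo q) (State fuel (q ∷ stack)) ⟧ (extend (ρRun q) ρ) j' → ρRun q j' ≡ true
    prefixed j' step = from (does-true-⇔ (q ≟ run j')) (to (state-step q j')
      (step-mono {c = leadsTo q} (λ q' j'' _ → state-sound fuel (q ∷ stack) ext sound' q' j'')
                 (to (step-sem ext (leadsTo q) (State fuel (q ∷ stack)) j') step)))

  -- completeness, by induction along the reading order: every prefixed point
  -- for q contains the positions of U where the run is in q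
  state-complete : ∀ fuel {s} (stack : Vec (Fin nQ) s) {ρ} → Extends w s ρ ρL →
                   Injective _≡_ _≡_ (lookup stack) → fuel + s ≡ nQ →
                   ∀ {U} → Closed U → StackComplete U stack ρ →
                   ∀ q j → U j → q ≡ run j → ⟦ State fuel stack q ⟧ ρ j
  state-complete fuel stack ext inj full closed complete q j Uj q≡ with any? (λ k → lookup stack k ≟ q)
  ... | yes (k , k≡q) = complete k j Uj (trans k≡q q≡)
  state-complete zero stack ext inj refl closed complete q j Uj q≡ | no missing =
    ⊥-elim (missing (injective-covers stack inj q))
  state-complete (suc fuel) {s} stack {ρ} ext inj full {U} closed complete q j Uj q≡ | no missing =
    λ X prefixed → least X prefixed j Uj q≡
    where
    least : ∀ X → (∀ j' → ⟦ Step _ (leadsTo q) (State fuel (q ∷ stack)) ⟧ (extend X ρ) j' → X j' ≡ true) →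
            ∀ r → U r → q ≡ run r → X r ≡ true
    least X prefixed = All.wfRec (earlier-wf d) 0ℓ _ λ r IH Ur q≡r →
      prefixed r (from (step-sem ext (leadsTo q) (State fuel (q ∷ stack)) r) (step-mono {c = leadsTo q}
        (λ q' j' r<j' → state-complete fuel (q ∷ stack) ext (push-injective stack q inj missing)
                          (trans (ℕₚ.+-suc fuel s) full) (earlier-trans d) (complete' r IH Ur) q' j' r<j')
        (from (state-step q r) q≡r)))
      where
      complete' : ∀ r → (∀ {j} → Earlier d r j → U j → q ≡ run j → X j ≡ true) → U r →
                  StackComplete (Earlier d r) (q ∷ stack) (extend X ρ)
      complete' r IH Ur zero    j' r<j' = IH r<j' (closed Ur r<j')
      complete' r IH Ur (suc k) j' r<j' = complete k j' (closed Ur r<j')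

  state-sem : ∀ q j → ⟦ StateF q ⟧ ρL j ⇔ (q ≡ run j)
  state-sem q j = mk⇔ (state-sound nQ [] (λ _ _ → refl) (λ ()) q j)
                      (state-complete nQ [] (λ _ _ → refl) (λ { {()} }) (ℕₚ.+-identityʳ nQ)
                                      {λ _ → ⊤} _ (λ ()) q j tt)

  output-sem : ∀ o j → ⟦ OutputF o ⟧ ρL j ⇔ (o ≡ out j)
  output-sem o j = ⇔-trans (step-sem (λ _ _ → refl) (outputs o) StateF j) (⇔-trans
    (mk⇔ (step-mono {c = outputs o} λ q j' _ → to (state-sem q j'))
         (step-mono {c = outputs o} λ q j' _ → from (state-sem q j')))
    (output-step o j))

module AcceptanceSemantics {A : Set} (w : Word A) {a b : ℕ} (d : Direction) (T : CMT a b)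
                           (lab' : Fin (len w) → Fin a) where
  open Semantics w
  open ReadingOrder w
  open DerivedSemantics w
  open Run w d T lab'
  open CMT T

  always-sem : ∀ atom → (∀ j → Dec (⟦ atom ⟧ᵃ j)) → ∀ F i₀ → toℕ i₀ ≡ 0 →
               ⟦ Always atom F ⟧ ρRun i₀ ⇔ (∀ j → ⟦ atom ⟧ᵃ j → F (run j) ≡ true)
  always-sem atom atom? F i₀ first =
    ⇔-trans (G-sem (neg atom ∨ᶠ ⋁ λ q → var q ∧ᶠ Cst (F q)) ρRun i₀ first)
            (Π-⇔ λ j → ⇔-trans (¬⊎-⇔ (atom? j)) (→-cong-⇔ ⇔-refl (in-F j)))
    where
    in-F : ∀ j → ⟦ ⋁ (λ q → var q ∧ᶠ Cst (F q)) ⟧ ρRun j ⇔ (F (run j) ≡ true)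
    in-F j = ⇔-trans (⋁-sem {ρ = ρRun} {j} _)
               (⇔-trans (Σ-⇔ λ q → does-true-⇔ (q ≟ run j) ×-⇔ Cst-sem {ρ = ρRun} (F q)) contract)

  acceptance-sem : ∀ i₀ → toℕ i₀ ≡ 0 → ⟦ Acceptance d T ⟧ ρRun i₀ ⇔ Accepting
  acceptance-sem i₀ first = always-sem (finalᵍ d) (finalᵍ? d) Fg i₀ first
                         ×-⇔ always-sem (finalᶜ d) (finalᶜ? d) Fc i₀ first

Comp-mono : ∀ {A} {Ψ : ∀ {m} → Formula A m → Set} {i j φ} → i ≤ j → Comp Ψ i φ → Comp Ψ j φ
Comp-mono {i = suc i} (s≤s i≤j) (n , ψ , ψ∈Ψ , σ , σ-height , φ≡) =
  n , ψ , ψ∈Ψ , σ , (λ x → Comp-mono i≤j (σ-height x)) , φ≡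

-- a formula ψ(τ₁, …, τₙ), kept as its outer layer ψ and the closed τⱼ
record Layered (A : Set) : Set where
  constructor layered
  field
    n     : ℕ
    outer : Formula A n
    inner : Fin n → Formula A 0

composed : ∀ {A} → Layered A → Formula A 0
composed (layered n ψ τ) = subst ψ τ

-- the letters of the next level are the outputs, named by the outer variables
nextLabels : ∀ {A b} → LabelFormulas A b b
nextLabels s o = var (s ↑ʳ o)

-- The encoding of a cascade whose first CMT reads the letters defined by L,
-- where the outer variables of L stand for the closed formulas σ: the outer
-- layer is the conjunction of the acceptance conditions of all levels, the
-- inner layer consists of the state formulas of all levels.
encode : ∀ {A a k} → Cascade a k → ∀ {m} → LabelFormulas A a m → (Fin m → Formula A 0) → Layered A
encode []            L σ = layered 0 TT (λ ())
encode ((d , T) ∷ C) L σ =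
  layered (nQ + n) (rename (_↑ˡ n) (Acceptance d T) ∧ᶠ rename (nQ ↑ʳ_) outer)
                   ((λ q → subst (StateF q) σ) ++ inner)
  where
  open CMT T
  open Encoding d T L
  open Layered (encode C nextLabels (λ o → subst (OutputF o) σ))

encode-height : ∀ {A a k} (C : Cascade a k) {m} (L : LabelFormulas A a m) (σ : Fin m → Formula A 0) {h} →
                (∀ {M} s x → Formulas M (L s x)) → (∀ x → Comp BRbase h (σ x)) →
                Formulas FutureMods (Layered.outer (encode C L σ)) ×
                (∀ j → Comp BRbase (h + k) (Layered.inner (encode C L σ) j))
encode-height []            L σ L-frag σ-height = (tt , tt) , λ ()
encode-height {k = suc k} ((d , T) ∷ C) {m} L σ {h} L-frag σ-height =
  (rename-frag (Acceptance d T) _ (acceptance-frag d T) , rename-frag outer _ (proj₁ rest)) ,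
  ++⁺ (Comp BRbase (h + suc k)) (λ q → Comp-mono h+1≤ (one-layer (StateF q) (stateF-frag q)))
                                (λ j → Comp-mono (ℕₚ.≤-reflexive (sym (ℕₚ.+-suc h k))) (proj₂ rest j))
  where
  open CMT T
  open Encoding d T L
  open EncodingFragment d T L (λ s x → L-frag s x)
  open Layered (encode C nextLabels (λ o → subst (OutputF o) σ))
  one-layer : (φ : Formula _ m) → Formulas (Mods d) φ → Comp BRbase (suc h) (subst φ σ)
  one-layer φ φ-frag = m , φ , Mods-BR d {ψ = φ} φ-frag , σ , σ-height , refl
  h+1≤ : suc h ≤ h + suc k
  h+1≤ = ℕₚ.≤-trans (s≤s (ℕₚ.m≤m+n h k)) (ℕₚ.≤-reflexive (sym (ℕₚ.+-suc h k)))
  rest = encode-height C nextLabels (λ o → subst (OutputF o) σ) (λ s x → tt)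
                       (λ o → one-layer (OutputF o) (outputF-frag o))

module CascadeStep {A : Set} (w : Word A) {a b : ℕ} (d : Direction) (T : CMT a b)
                   (lab' : Fin (len w) → Fin a) {m : ℕ} (L : LabelFormulas A a m)
                   (σ : Fin m → Formula A 0) (ρL : Semantics.Val w m) (L-defines : Defines w L ρL lab')
                   (σ-realises : SubstitutionSemantics.Realises w σ (Semantics.emptyVal w) ρL) where
  open Semantics w
  open SubstitutionSemantics w
  open Run w d T lab'
  open LevelSemantics w d T lab' L ρL L-defines
  open AcceptanceSemantics w d T lab'
  open Encoding d T L
  open CMT T

  states-realise : Realises (λ q → subst (StateF q) σ) emptyVal ρRun
  states-realise q j = ⇔-trans (subst-sem (StateF q) σ σ-realises j)
                         (⇔-trans (state-sem q j) (⇔-sym (does-true-⇔ (q ≟ run j))))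

  acceptance-closed : ∀ i₀ → toℕ i₀ ≡ 0 →
                      ⟦ subst (Acceptance d T) (λ q → subst (StateF q) σ) ⟧ emptyVal i₀ ⇔ Accepting
  acceptance-closed i₀ first =
    ⇔-trans (subst-sem (Acceptance d T) _ states-realise i₀) (acceptance-sem i₀ first)

  next-defines : (o : Pos → Fin b) → Defines w nextLabels (λ x j → o j == x) o
  next-defines o s ρ ext x j = ⇔-trans (≡-true-⇔ (ext x j)) (does-true-⇔ (o j ≟ x))

  next-realises : (o : Pos → Fin b) → (∀ i → o i ≡ out i) →
                  Realises (λ x → subst (OutputF x) σ) emptyVal (λ x j → o j == x)
  next-realises o o≗out x j = ⇔-trans (subst-sem (OutputF x) σ σ-realises j) (⇔-trans (output-sem x j)
    (⇔-trans (mk⇔ (λ x≡ → trans (o≗out j) (sym x≡)) (λ o≡ → trans (sym o≡) (o≗out j)))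
             (⇔-sym (does-true-⇔ (o j ≟ x)))))

encode-sem : ∀ {A a k} (C : Cascade a k) {m} (L : LabelFormulas A a m) (σ : Fin m → Formula A 0)
             (w : Word A) (lab' : Fin (len w) → Fin a) (ρL : Semantics.Val w m) →
             Defines w L ρL lab' → SubstitutionSemantics.Realises w σ (Semantics.emptyVal w) ρL →
             ∀ i₀ → toℕ i₀ ≡ 0 →
             Semantics.⟦_⟧ w (composed (encode C L σ)) (Semantics.emptyVal w) i₀ ⇔ Accepts C (relabel w lab')
encode-sem [] L σ w lab' ρL L-defines σ-realises i₀ first =
  mk⇔ (λ _ → tt) (λ _ → DerivedSemantics.TT-sem w {ρ = Semantics.emptyVal w})
encode-sem ((d , T) ∷ C) L σ w lab' ρL L-defines σ-realises i₀ first = mk⇔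
  (λ (acc , rest) → out , from (runsTo-⇔ i₀ out) (to acc-part acc , λ _ → refl)
                        , to (next-level out λ _ → refl) (to rest-part rest))
  (λ (o , runs , accepts) → let acc , o≗out = to (runsTo-⇔ i₀ o) runs
                            in from acc-part acc , from rest-part (from (next-level o o≗out) accepts))
  where
  open Semantics w
  open SubstitutionSemantics w
  open Run w d T lab' using (out; Accepting)
  open RunCharacterisation w d T lab' using (runsTo-⇔)
  open CascadeStep w d T lab' L σ ρL L-defines σ-realises
  open CMT T
  open Encoding d T L
  σ' = λ o → subst (OutputF o) σ
  open Layered (encode C nextLabels σ')
  τ = (λ q → subst (StateF q) σ) ++ inner
  acc-part : ⟦ subst (rename (_↑ˡ n) (Acceptance d T)) τ ⟧ emptyVal i₀ ⇔ Accepting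
  acc-part = ⇔-trans (formula-≡ (subst-rename (Acceptance d T) (_↑ˡ n) (lookup-++ˡ _ inner)))
                     (acceptance-closed i₀ first)
  rest-part : ⟦ subst (rename (nQ ↑ʳ_) outer) τ ⟧ emptyVal i₀ ⇔
              ⟦ composed (encode C nextLabels σ') ⟧ emptyVal i₀
  rest-part = formula-≡ (subst-rename outer (nQ ↑ʳ_) (lookup-++ʳ (λ q → subst (StateF q) σ) inner))
  next-level : ∀ o → (∀ i → o i ≡ out i) →
               ⟦ composed (encode C nextLabels σ') ⟧ emptyVal i₀ ⇔ Accepts C (relabel w o)
  next-level o o≗out = encode-sem C nextLabels σ' w o _ (next-defines o) (next-realises o o≗out) i₀ first

proposition5 : {a k : ℕ} (C : Cascade a k) →
    Σ (Formula (Fin a) 0) λ φ →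
    Comp BRbase (suc k) φ ×
    ((w : Word (Fin a)) → NonEmpty w → (Semantics.Sat w φ ⇔ Accepts C w))
proposition5 {a} {k} C = composed E , (n , outer , inj₁ outer-future , inner , inner-height , refl) , sat-⇔
  where
  letters : LabelFormulas (Fin a) a 0
  letters s x = pos (letter x)
  E = encode C letters (λ ())
  open Layered E
  heights = encode-height C letters (λ ()) {h = 0} (λ s x → tt) (λ ())
  outer-future = proj₁ heights
  inner-height = proj₂ heights
  sat-⇔ : (w : Word (Fin a)) → NonEmpty w → Semantics.Sat w (composed E) ⇔ Accepts C w
  sat-⇔ w (n' , len≡) = mk⇔ (λ (i , first , holds) → to (at i first) holds)
                            (λ accepts → i₀ , toℕ-fromℕ< 0<len , from (at i₀ (toℕ-fromℕ< 0<len)) accepts)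
    where
    at = encode-sem C letters (λ ()) w (lab w) (λ ()) (λ s ρ ext x j → ⇔-refl) (λ ())
    0<len = ℕₚ.≤-trans (s≤s z≤n) (ℕₚ.≤-reflexive (sym len≡))
    i₀ = fromℕ< 0<len
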